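{- Let $\mathcal{Z}$ be a zero-set and let $(\vec r,\vec c)$ be enhancements, with associated Young diagrams $\mathcal{R}=\{(u,v)\in\mathbb{Z}_+^2:u<r_v\}$ and $\mathcal{C}=\{(u,v)\in\mathbb{Z}_+^2:v<c_u\}$. Then $(\vec r,\vec c)$ spans for $\mathcal{Z}$ if and only if $\mathcal{Z}\subseteq\mathcal{R}\boxplus\mathcal{C}$.
   Context: $\mathbb{Z}_+=\{0,1,2,\dots\}$, $\mathbb{N}=\{1,2,\dots\}$. For $a,b\in\mathbb{N}$, $R_{a,b}=([0,a-1]\times[0,b-1])\cap\mathbb{Z}_+^2$; a zero-set is a union of $R_{a,b}$ over a finite $\mathcal{I}\subseteq\mathbb{N}^2$ (possibly empty). For $X\subseteq\mathbb{Z}_+^2$, $X^c=\mathbb{Z}_+^2\setminus X$; the infimal sum of Young diagrams (downward closed subsets of $\mathbb{Z}_+^2$ for the coordinatewise order) is $X\boxplus Y=(X^c+Y^c)^c$, with $+$ the Minkowski sum. For $x\in\mathbb{Z}_+^2$ and $A\subseteq\mathbb{Z}_+^2$, $\mathtt{row}(x,A)$ and $\mathtt{col}(x,A)$ are the numbers of points of $A$ on the horizontal and vertical line through $x$. Enhancements $\vec r=(r_0,r_1,\dots)$, $\vec c=(c_0,c_1,\dots)$ are weakly decreasing sequences of nonnegative integers; $\mathcal{T}_{\mathrm{en}}(A)=A\cup\{(i,j)\in\mathbb{Z}_+^2:(\mathtt{row}((i,j),A)+r_j,\mathtt{col}((i,j),A)+c_i)\notin\mathcal{Z}\}$; $(\vec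 r,\vec c)$ spans for $\mathcal{Z}$ if $\bigcup_{t\ge0}\mathcal{T}_{\mathrm{en}}^t(\emptyset)=\mathbb{Z}_+^2$. -}

module Defs where

open import Data.Nat using (ℕ; suc; _+_; _∸_; _≤_; _<_)
open import Data.Fin using (Fin)
open import Data.Product using (Σ; _×_; _,_; ∃)
open import Data.Sum using (_⊎_)
open import Data.List using (List)
open import Data.List.Relation.Unary.All using (All)
open import Data.List.Relation.Unary.Any using (Any)
open import Data.Empty using (⊥)
open import Relation.Nullary using (¬_)
open import Relation.Binary.PropositionalEquality using (_≡_)
open import Function.Definitions using (Injective)

Pt : Set
Pt = ℕ × ℕ

Subset : Set₁
Subset = Pt → Set

PositiveIndices : List Pt → Set
PositiveIndices I = All (λ { (a , b) → 1 ≤ a × 1 ≤ b }) I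

InRect : Pt → Pt → Set
InRect (a , b) (x , y) = x < a × y < b

ZeroSet : List Pt → Subset
ZeroSet I z = Any (λ ab → InRect ab z) I

WeaklyDecreasing : (ℕ → ℕ) → Set
WeaklyDecreasing r = ∀ i → r (suc i) ≤ r i

AtLeast : (ℕ → Set) → ℕ → Set
AtLeast P m = Σ (Fin m → ℕ) (λ f → Injective _≡_ _≡_ f × (∀ k → P (f k)))

-- row((i,j),A) + r_j ≥ p   (row = number of points of A on the line y = j)
RowGe : Subset → (ℕ → ℕ) → Pt → ℕ → Set
RowGe A r (i , j) p = AtLeast (λ i' → A (i' , j)) (p ∸ r j)

-- col((i,j),A) + c_i ≥ q   (col = number of points of A on the line x = i)
ColGe : Subset → (ℕ → ℕ) → Pt → ℕ → Set
ColGe A c (i , j) q = AtLeast (λ j' → A (i , j')) (q ∸ c i)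

-- (row(x,A) + r_j , col(x,A) + c_i) ∉ 𝒵 = ⋃_{(p,q)∈𝓘} R_{p,q}:
-- for every (p,q) ∈ 𝓘, the first coordinate is ≥ p or the second is ≥ q.
-- (Counts may be infinite, which is why they are expressed via AtLeast.)
NotInZ : List Pt → (ℕ → ℕ) → (ℕ → ℕ) → Subset → Pt → Set
NotInZ I r c A x = All (λ { (p , q) → RowGe A r x p ⊎ ColGe A c x q }) I

Ten : List Pt → (ℕ → ℕ) → (ℕ → ℕ) → Subset → Subset
Ten I r c A x = A x ⊎ NotInZ I r c A x

∅ : Subset
∅ _ = ⊥

TenIter : List Pt → (ℕ → ℕ) → (ℕ → ℕ) → ℕ → Subset
TenIter I r c 0 = ∅
TenIter I r c (suc t) = Ten I r c (TenIter I r c t)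

Spans : List Pt → (ℕ → ℕ) → (ℕ → ℕ) → Set
Spans I r c = ∀ x → ∃ λ t → TenIter I r c t x

_+ₚ_ : Pt → Pt → Pt
(a , b) +ₚ (c , d) = (a + c , b + d)

Compl : Subset → Subset
Compl X x = ¬ X x

Minkowski : Subset → Subset → Subset
Minkowski X Y z = Σ Pt (λ x → Σ Pt (λ y → X x × Y y × x +ₚ y ≡ z))

_⊞_ : Subset → Subset → Subset
X ⊞ Y = Compl (Minkowski (Compl X) (Compl Y))

_⊆_ : Subset → Subset → Set
X ⊆ Y = ∀ x → X x → Y x

RDiag : (ℕ → ℕ) → Subset
RDiag r (u , v) = u < r v

CDiag : (ℕ → ℕ) → Subset
CDiag c (u , v) = v < c u

module Submission where

-- Write 𝒯 for 𝒯_en and Aₜ = 𝒯ᵗ(∅).  Both directions compare the pair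
-- (row + r_j , col + c_i) at a point (i , j) with a corner of 𝒵.
--
-- Necessity.  Suppose (u , v) ∉ ℛ, (u' , v') ∉ 𝒞 and (u + u' , v + v') ∈ 𝒵.
-- Then no Aₜ meets the quadrant [u',∞) × [v,∞): at a quadrant point (i , j)
-- the infected points of its row lie left of u' and those of its column lie
-- below v, while r_j ≤ r_v ≤ u and c_i ≤ c_{u'} ≤ v' by monotonicity, so the
-- enhanced counts are dominated by a point of 𝒵 and (i , j) stays healthy.
--
-- Sufficiency.  If 𝒵 ⊆ ℛ ⊞ 𝒞 then (r_j + i , j + c_i) ∉ 𝒵, being the sum of
-- (r_j , j) ∉ ℛ and (i , c_i) ∉ 𝒞.  Hence a point is infected as soon as the
-- segments to its left and below it are; by induction on d every point with
-- i + j < d lies in A_d.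

open import Defs
open import Data.Nat using (ℕ; zero; suc; _+_; _∸_; _≤_; _<_; _≤?_; _≤′_; ≤′-refl; ≤′-step)
open import Data.Nat.Properties
open import Data.Fin using (Fin; toℕ; fromℕ<; inject≤)
open import Data.Fin.Properties using (toℕ-injective; toℕ<n; toℕ-fromℕ<; inject≤-injective; injective⇒≤)
open import Data.Product using (_,_; proj₁; proj₂)
open import Data.Sum using (_⊎_; inj₁; inj₂)
open import Data.List using (List)
open import Data.List.Relation.Unary.All using (lookupAny; tabulate)
open import Data.List.Membership.Propositional using (_∈_; lose)
open import Data.Empty using (⊥-elim)
open import Relation.Nullary using (¬_; yes; no)
open import Relation.Binary.PropositionalEquality using (_≡_; refl; sym; trans; cong; subst)
open import Function.Bundles using (_⇔_; mk⇔)

atLeast-initialSegment : ∀ {P : ℕ → Set} n → (∀ k → k < n → P k) → AtLeast P n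
atLeast-initialSegment n seg = toℕ , toℕ-injective , λ k → seg (toℕ k) (toℕ<n k)

atLeast-weaken : ∀ {P : ℕ → Set} {m n} → n ≤ m → AtLeast P m → AtLeast P n
atLeast-weaken n≤m (f , f-inj , f∈P) =
  (λ k → f (inject≤ k n≤m)) ,
  (λ {x} {y} eq → inject≤-injective n≤m n≤m x y (f-inj eq)) ,
  (λ k → f∈P (inject≤ k n≤m))

atLeast-bounded : ∀ {P : ℕ → Set} {m} u → (∀ k → P k → k < u) → AtLeast P m → m ≤ u
atLeast-bounded {P} {m} u below (f , f-inj , f∈P) = injective⇒≤ {f = g} g-inj
  where
  g : Fin m → Fin u
  g k = fromℕ< (below (f k) (f∈P k))
  g-inj : ∀ {x y} → g x ≡ g y → x ≡ y
  g-inj {x} {y} eq = f-inj (trans (sym (toℕ-fromℕ< (below (f x) (f∈P x))))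
                            (trans (cong toℕ eq) (toℕ-fromℕ< (below (f y) (f∈P y)))))

below-threshold : ∀ {P : ℕ → Set} u → (∀ k → u ≤ k → ¬ P k) → ∀ k → P k → k < u
below-threshold u excluded k pk with u ≤? k
... | yes u≤k = ⊥-elim (excluded k u≤k pk)
... | no u≰k = ≰⇒> u≰k

rowGe-intro : ∀ {A r i j p} → (∀ k → k < i → A (k , j)) → p ≤ r j + i → RowGe A r (i , j) p
rowGe-intro {A} {r} {i} {j} {p} left p≤ =
  atLeast-weaken {λ k → A (k , j)} (m≤n+o⇒m∸n≤o p (r j) p≤) (atLeast-initialSegment {λ k → A (k , j)} i left)

colGe-intro : ∀ {A c i j q} → (∀ k → k < j → A (i , k)) → q ≤ c i + j → ColGe A c (i , j) q
colGe-intro {A} {c} {i} {j} {q} below q≤ =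
  atLeast-weaken {λ k → A (i , k)} (m≤n+o⇒m∸n≤o q (c i) q≤) (atLeast-initialSegment {λ k → A (i , k)} j below)

rowGe-bound : ∀ {A r i j p} u → (∀ k → A (k , j) → k < u) → RowGe A r (i , j) p → p ≤ r j + u
rowGe-bound {A} {r} {j = j} {p} u rowBelow enough =
  ≤-trans (m≤n+m∸n p (r j)) (+-monoʳ-≤ (r j) (atLeast-bounded {λ k → A (k , j)} u rowBelow enough))

colGe-bound : ∀ {A c i j q} v → (∀ k → A (i , k) → k < v) → ColGe A c (i , j) q → q ≤ c i + v
colGe-bound {A} {c} {i} {q = q} v colBelow enough =
  ≤-trans (m≤n+m∸n q (c i)) (+-monoʳ-≤ (c i) (atLeast-bounded {λ k → A (i , k)} v colBelow enough))

-- If the enhanced counts at x are dominated by (P , Q) and x escapes 𝒵,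
-- then (P , Q) ∉ 𝒵: zero-sets are downward closed.
notInZ-dominated : ∀ {I r c A x P Q} →
  (∀ p → RowGe A r x p → p ≤ P) → (∀ q → ColGe A c x q → q ≤ Q) →
  NotInZ I r c A x → ¬ ZeroSet I (P , Q)
notInZ-dominated rowDom colDom escapes inZ with lookupAny escapes inZ
... | inj₁ rowGe , (P<p , _) = <⇒≱ P<p (rowDom _ rowGe)
... | inj₂ colGe , (_ , Q<q) = <⇒≱ Q<q (colDom _ colGe)

antitone : ∀ {r} → WeaklyDecreasing r → ∀ {a b} → a ≤ b → r b ≤ r a
antitone {r} decreasing a≤b = go (≤⇒≤′ a≤b)
  where
  go : ∀ {a b} → a ≤′ b → r b ≤ r a
  go ≤′-refl = ≤-refl
  go (≤′-step a≤′b) = ≤-trans (decreasing _) (go a≤′b)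

quadrant-healthy : ∀ I r c → WeaklyDecreasing r → WeaklyDecreasing c →
  ∀ {u v u' v'} → ¬ RDiag r (u , v) → ¬ CDiag c (u' , v') → ZeroSet I (u + u' , v + v') →
  ∀ t {i j} → u' ≤ i → v ≤ j → ¬ TenIter I r c t (i , j)
quadrant-healthy I r c decR decC {u} {v} {u'} {v'} ∉R ∉C corner = healthy
  where
  healthy : ∀ t {i j} → u' ≤ i → v ≤ j → ¬ TenIter I r c t (i , j)
  healthy zero _ _ ()
  healthy (suc t) u'≤i v≤j (inj₁ earlier) = healthy t u'≤i v≤j earlier
  healthy (suc t) {i} {j} u'≤i v≤j (inj₂ escapes) =
    notInZ-dominated {I} {r} {c} {TenIter I r c t} {i , j} rowDom colDom escapes corner
    where
    rowDom : ∀ p → RowGe (TenIter I r c t) r (i , j) p → p ≤ u + u'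
    rowDom p enough = ≤-trans
      (rowGe-bound {TenIter I r c t} {r} {i} u' (below-threshold u' (λ k u'≤k → healthy t u'≤k v≤j)) enough)
      (+-monoˡ-≤ u' (≤-trans (antitone decR v≤j) (≮⇒≥ ∉R)))
    colDom : ∀ q → ColGe (TenIter I r c t) c (i , j) q → q ≤ v + v'
    colDom q enough = subst (q ≤_) (+-comm v' v) (≤-trans
      (colGe-bound {TenIter I r c t} {c} {i} {j} v (below-threshold v (λ k v≤k → healthy t u'≤i v≤k)) enough)
      (+-monoˡ-≤ v (≤-trans (antitone decC u'≤i) (≮⇒≥ ∉C))))

corner-outside : ∀ {I r c} → ZeroSet I ⊆ (RDiag r ⊞ CDiag c) → ∀ i j → ¬ ZeroSet I (r j + i , j + c i)
corner-outside sub i j inZ = sub _ inZ ((_ , j) , (i , _) , <-irrefl refl , <-irrefl refl , refl)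

infected-if-segments : ∀ {I r c A} → ZeroSet I ⊆ (RDiag r ⊞ CDiag c) → ∀ {i j} →
  (∀ k → k < i → A (k , j)) → (∀ k → k < j → A (i , k)) → NotInZ I r c A (i , j)
infected-if-segments {I} {r} {c} {A} sub {i} {j} left below = tabulate escapes
  where
  escapes : ∀ {pq} → pq ∈ I → RowGe A r (i , j) (proj₁ pq) ⊎ ColGe A c (i , j) (proj₂ pq)
  escapes {p , q} pq∈I with p ≤? r j + i | q ≤? c i + j
  ... | yes p≤ | _ = inj₁ (rowGe-intro {A} {r} left p≤)
  ... | no _ | yes q≤ = inj₂ (colGe-intro {A} {c} below q≤)
  ... | no p≰ | no q≰ = ⊥-elim (corner-outside sub i j
         (lose pq∈I (≰⇒> p≰ , subst (_< q) (+-comm (c i) j) (≰⇒> q≰))))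

staircase : ∀ {I r c} → ZeroSet I ⊆ (RDiag r ⊞ CDiag c) →
  ∀ d {i j} → i + j < d → TenIter I r c d (i , j)
staircase sub zero ()
staircase sub (suc d) {i} {j} i+j<1+d = inj₂ (infected-if-segments sub
  (λ k k<i → staircase sub d (<-≤-trans (+-monoˡ-< j k<i) i+j≤d))
  (λ k k<j → staircase sub d (<-≤-trans (+-monoʳ-< i k<j) i+j≤d)))
  where
  i+j≤d : i + j ≤ d
  i+j≤d = m<1+n⇒m≤n i+j<1+d

lemma2p6 : (I : List Pt) → PositiveIndices I →
    (r c : ℕ → ℕ) → WeaklyDecreasing r → WeaklyDecreasing c →
    Spans I r c ⇔ (ZeroSet I ⊆ (RDiag r ⊞ CDiag c))
-- Positivity of the indices in 𝓘 is not needed for either direction.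
lemma2p6 I _ r c decR decC = mk⇔ necessary sufficient
  where
  necessary : Spans I r c → ZeroSet I ⊆ (RDiag r ⊞ CDiag c)
  necessary spans _ inZ ((u , v) , (u' , v') , ∉R , ∉C , refl) with spans (u' , v)
  ... | t , infected = quadrant-healthy I r c decR decC ∉R ∉C inZ t ≤-refl ≤-refl infected
  sufficient : ZeroSet I ⊆ (RDiag r ⊞ CDiag c) → Spans I r c
  sufficient sub (i , j) = suc (i + j) , staircase sub (suc (i + j)) ≤-refl
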